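{- Let $k,l\ge 1$ be integers and $U=\{1,\dots,2k+l\}$. A deal is a triple $(A,B,C)$ of pairwise disjoint subsets of $U$ with $|A|=|B|=k$, $|C|=l$, $A\cup B\cup C=U$. Let $\mathcal{A}$ be a nonempty family of $k$-element subsets of $U$ (the hands of Anne for which Anne makes a given public announcement $\alpha$). Suppose that after the announcement Cath learns nothing about cards other than her own, in the sense that for every deal $(A,B,C)$ with $A\in\mathcal{A}$ and every card $x\in U\setminus C$ there exist deals $(A',B',C)$ and $(A'',B'',C)$ with $A',A''\in\mathcal{A}$, $x\in A'$ and $x\in B''$. Then $$\bigcup_{A\in\mathcal{A}}A=U\qquad\text{and}\qquad\bigcap_{A\in\mathcal{A}}A=\emptyset .$$
   Context: This is the generalized Russian Cards Problem RCP$(k;l)$: Anne and Bill hold $k$ cards each and Cath holds $l$ cards from a pack of $2k+l$ cards. Cath's knowledge after Anne's announcement $\alpha$ is modeled by: the deals Cath considers possible at a deal $(A,B,C)$ are exactly those deals with the same Cath hand $C$ in which Anne's hand belongs to $\mathcal{A}$. -}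

module Defs where

open import Data.Nat using (ℕ; _+_; _*_)
open import Data.Fin using (Fin)
open import Data.Fin.Subset using (Subset; _∈_; _∉_; ∣_∣)
open import Data.Product using (_×_; Σ-syntax; ∃-syntax)
open import Data.Sum using (_⊎_)
open import Relation.Nullary using (¬_)
open import Relation.Binary.PropositionalEquality using (_≡_)

Card : ℕ → ℕ → Set
Card k l = Fin (2 * k + l)

Hand : ℕ → ℕ → Set
Hand k l = Subset (2 * k + l)

record IsDeal (k l : ℕ) (A B C : Hand k l) : Set where
  field
    disjAB : ∀ (x : Card k l) → ¬ (x ∈ A × x ∈ B)
    disjAC : ∀ (x : Card k l) → ¬ (x ∈ A × x ∈ C)
    disjBC : ∀ (x : Card k l) → ¬ (x ∈ B × x ∈ C)
    sizeA  : ∣ A ∣ ≡ k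
    sizeB  : ∣ B ∣ ≡ k
    sizeC  : ∣ C ∣ ≡ l
    cover  : ∀ (x : Card k l) → x ∈ A ⊎ (x ∈ B ⊎ x ∈ C)

-- A family 𝒜 of hands (Anne's hands for which she announces α),
-- given as a predicate on subsets; it consists of k-element subsets.
Family : ℕ → ℕ → Set₁
Family k l = Hand k l → Set

CathIgnorant : (k l : ℕ) → Family k l → Set
CathIgnorant k l 𝒜 =
  ∀ (A B C : Hand k l) → IsDeal k l A B C → 𝒜 A →
  ∀ (x : Card k l) → x ∉ C →
    (∃[ A' ] ∃[ B' ] (IsDeal k l A' B' C × 𝒜 A' × x ∈ A'))
    × (∃[ A'' ] ∃[ B'' ] (IsDeal k l A'' B'' C × 𝒜 A'' × x ∈ B''))

-- Fix any A₀ ∈ 𝒜 and a card x. Completing A₀ to a deal (A₀, B, C) with x ∉ C is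
-- always possible: if x ∉ A₀, put x into Bill's hand, which is nonempty as k ≥ 1.
-- Cath's ignorance at this deal then yields some A' ∈ 𝒜 containing x, and some
-- A'' ∈ 𝒜 whose deal gives x to Bill, so x ∉ A''.
module Submission where

open import Defs
open import Data.Nat using (ℕ; zero; suc; _+_; _*_; _∸_; _≤_; _≥_; z≤n; s≤s)
open import Data.Nat.Properties
  using (+-suc; +-identityʳ; +-cancelˡ-≡; m≤m+n; ≤-<-trans; m+n≤o⇒m≤o∸n)
open import Data.Fin using (Fin) renaming (zero to fzero; suc to fsuc)
open import Data.Fin.Subset using (Subset; inside; outside; _∈_; _∉_; ∁; ∣_∣)
open import Data.Fin.Subset.Properties
  using (_∈?_; ∣∁p∣≡n∸∣p∣; x∉p⇒x∈∁p; x∈p⇒∣p-x∣<∣p∣)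
open import Data.Vec using ([]; _∷_; here; there)
open import Data.Product using (_×_; _,_; ∃-syntax; ∃₂)
open import Data.Sum using (_⊎_; inj₁; inj₂)
import Data.Sum as Sum
open import Relation.Nullary using (¬_; yes; no; contradiction)
open import Function using (_∘_)
open import Relation.Binary.PropositionalEquality
  using (_≡_; refl; sym; trans; cong; cong₂; subst; module ≡-Reasoning)

private
  variable
    n : ℕ
    A B C : Subset n

data Partition : Subset n → Subset n → Subset n → Set where
  []  : Partition [] [] []
  inA : Partition A B C → Partition (inside ∷ A) (outside ∷ B) (outside ∷ C)
  inB : Partition A B C → Partition (outside ∷ A) (inside ∷ B) (outside ∷ C)
  inC : Partition A B C → Partition (outside ∷ A) (outside ∷ B) (inside ∷ C)

Partition-swap₁₂ : Partition A B C → Partition B A C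
Partition-swap₁₂ []      = []
Partition-swap₁₂ (inA p) = inB (Partition-swap₁₂ p)
Partition-swap₁₂ (inB p) = inA (Partition-swap₁₂ p)
Partition-swap₁₂ (inC p) = inC (Partition-swap₁₂ p)

Partition-swap₂₃ : Partition A B C → Partition A C B
Partition-swap₂₃ []      = []
Partition-swap₂₃ (inA p) = inA (Partition-swap₂₃ p)
Partition-swap₂₃ (inB p) = inC (Partition-swap₂₃ p)
Partition-swap₂₃ (inC p) = inB (Partition-swap₂₃ p)

Partition-disjoint₁₂ : Partition A B C → ∀ x → ¬ (x ∈ A × x ∈ B)
Partition-disjoint₁₂ (inA p) fzero    (_ , ())
Partition-disjoint₁₂ (inB p) fzero    (() , _)
Partition-disjoint₁₂ (inC p) fzero    (() , _)
Partition-disjoint₁₂ (inA p) (fsuc x) (there a , there b) = Partition-disjoint₁₂ p x (a , b)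
Partition-disjoint₁₂ (inB p) (fsuc x) (there a , there b) = Partition-disjoint₁₂ p x (a , b)
Partition-disjoint₁₂ (inC p) (fsuc x) (there a , there b) = Partition-disjoint₁₂ p x (a , b)

Partition-covers : Partition A B C → ∀ x → x ∈ A ⊎ (x ∈ B ⊎ x ∈ C)
Partition-covers (inA p) fzero    = inj₁ here
Partition-covers (inB p) fzero    = inj₂ (inj₁ here)
Partition-covers (inC p) fzero    = inj₂ (inj₂ here)
Partition-covers (inA p) (fsuc x) = Sum.map there (Sum.map there there) (Partition-covers p x)
Partition-covers (inB p) (fsuc x) = Sum.map there (Sum.map there there) (Partition-covers p x)
Partition-covers (inC p) (fsuc x) = Sum.map there (Sum.map there there) (Partition-covers p x)

Partition-size : Partition {n} A B C → ∣ A ∣ + ∣ B ∣ + ∣ C ∣ ≡ n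
Partition-size []      = refl
Partition-size (inA p) = cong suc (Partition-size p)
Partition-size {A = A} (inB {B = B} {C = C} p) =
  trans (cong (_+ ∣ C ∣) (+-suc ∣ A ∣ ∣ B ∣)) (cong suc (Partition-size p))
Partition-size {A = A} {B = B} (inC {C = C} p) =
  trans (+-suc (∣ A ∣ + ∣ B ∣) ∣ C ∣) (cong suc (Partition-size p))

completion : (A : Subset n) (m : ℕ) → m ≤ ∣ ∁ A ∣ →
             ∃₂ λ B C → Partition A B C × ∣ B ∣ ≡ m
completion []           zero    z≤n = [] , [] , [] , refl
completion (inside ∷ A) m       m≤ with completion A m m≤
... | B , C , p , ∣B∣≡m = _ , _ , inA p , ∣B∣≡m
completion (outside ∷ A) zero   _  with completion A zero z≤n
... | B , C , p , ∣B∣≡0 = _ , _ , inC p , ∣B∣≡0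
completion (outside ∷ A) (suc m) (s≤s m≤) with completion A m m≤
... | B , C , p , ∣B∣≡m = _ , _ , inB p , cong suc ∣B∣≡m

∉⇒1≤∣∁∣ : ∀ {x : Fin n} → x ∉ A → 1 ≤ ∣ ∁ A ∣
∉⇒1≤∣∁∣ x∉A = ≤-<-trans z≤n (x∈p⇒∣p-x∣<∣p∣ (x∉p⇒x∈∁p x∉A))

completion-through : (A : Subset n) (x : Fin n) → x ∉ A → (m : ℕ) → 1 ≤ m → m ≤ ∣ ∁ A ∣ →
                     ∃₂ λ B C → Partition A B C × ∣ B ∣ ≡ m × x ∈ B
completion-through (inside ∷ A)  fzero    x∉A _ _ _ = contradiction here x∉A
completion-through (outside ∷ A) fzero    _ (suc m) _ (s≤s m≤) with completion A m m≤
... | B , C , p , ∣B∣≡m = _ , _ , inB p , cong suc ∣B∣≡m , here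
completion-through (inside ∷ A)  (fsuc x) x∉A m 1≤m m≤
  with completion-through A x (x∉A ∘ there) m 1≤m m≤
... | B , C , p , ∣B∣≡m , x∈B = _ , _ , inA p , ∣B∣≡m , there x∈B
completion-through (outside ∷ A) (fsuc x) x∉A (suc zero) _ _
  with completion-through A x (x∉A ∘ there) 1 (s≤s z≤n) (∉⇒1≤∣∁∣ (x∉A ∘ there))
... | B , C , p , ∣B∣≡1 , x∈B = _ , _ , inC p , ∣B∣≡1 , there x∈B
completion-through (outside ∷ A) (fsuc x) x∉A (suc (suc m)) _ (s≤s m≤)
  with completion-through A x (x∉A ∘ there) (suc m) (s≤s z≤n) m≤
... | B , C , p , ∣B∣≡m , x∈B = _ , _ , inB p , cong suc ∣B∣≡m , there x∈B

completion-avoiding : (A : Subset n) (m : ℕ) → 1 ≤ m → m ≤ ∣ ∁ A ∣ → (x : Fin n) →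
                      ∃₂ λ B C → Partition A B C × ∣ B ∣ ≡ m × x ∉ C
completion-avoiding A m 1≤m m≤ x with x ∈? A
... | yes x∈A with completion A m m≤
...   | B , C , p , ∣B∣≡m =
  B , C , p , ∣B∣≡m , λ x∈C → Partition-disjoint₁₂ (Partition-swap₂₃ p) x (x∈A , x∈C)
completion-avoiding A m 1≤m m≤ x | no x∉A with completion-through A x x∉A m 1≤m m≤
...   | B , C , p , ∣B∣≡m , x∈B =
  B , C , p , ∣B∣≡m , λ x∈C →
    Partition-disjoint₁₂ (Partition-swap₂₃ (Partition-swap₁₂ p)) x (x∈B , x∈C)

module _ {k l : ℕ} where

  2k≡k+k : 2 * k ≡ k + k
  2k≡k+k = cong (k +_) (+-identityʳ k)

  Partition⇒IsDeal : {A B C : Hand k l} → Partition A B C → ∣ A ∣ ≡ k → ∣ B ∣ ≡ k →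
                     IsDeal k l A B C
  Partition⇒IsDeal {A} {B} {C} p ∣A∣≡k ∣B∣≡k = record
    { disjAB = Partition-disjoint₁₂ p
    ; disjAC = Partition-disjoint₁₂ (Partition-swap₂₃ p)
    ; disjBC = Partition-disjoint₁₂ (Partition-swap₂₃ (Partition-swap₁₂ p))
    ; sizeA  = ∣A∣≡k
    ; sizeB  = ∣B∣≡k
    ; sizeC  = +-cancelˡ-≡ (k + k) ∣ C ∣ l k+k+∣C∣≡k+k+l
    ; cover  = Partition-covers p
    }
    where
    open ≡-Reasoning
    k+k+∣C∣≡k+k+l : k + k + ∣ C ∣ ≡ k + k + l
    k+k+∣C∣≡k+k+l = begin
      k + k + ∣ C ∣         ≡⟨ cong₂ (λ a b → a + b + ∣ C ∣) (sym ∣A∣≡k) (sym ∣B∣≡k) ⟩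
      ∣ A ∣ + ∣ B ∣ + ∣ C ∣ ≡⟨ Partition-size p ⟩
      2 * k + l             ≡⟨ cong (_+ l) 2k≡k+k ⟩
      k + k + l             ∎

  k≤∣∁A∣ : (A : Hand k l) → ∣ A ∣ ≡ k → k ≤ ∣ ∁ A ∣
  k≤∣∁A∣ A ∣A∣≡k = subst (k ≤_) (sym ∣∁A∣≡2k+l∸k) (m+n≤o⇒m≤o∸n k k+k≤2k+l)
    where
    ∣∁A∣≡2k+l∸k : ∣ ∁ A ∣ ≡ 2 * k + l ∸ k
    ∣∁A∣≡2k+l∸k = trans (∣∁p∣≡n∸∣p∣ A) (cong (2 * k + l ∸_) ∣A∣≡k)
    k+k≤2k+l : k + k ≤ 2 * k + l
    k+k≤2k+l = subst (_≤ 2 * k + l) 2k≡k+k (m≤m+n (2 * k) l)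

  deal-avoiding : k ≥ 1 → (A : Hand k l) → ∣ A ∣ ≡ k → (x : Card k l) →
                  ∃₂ λ B C → IsDeal k l A B C × x ∉ C
  deal-avoiding k≥1 A ∣A∣≡k x with completion-avoiding A k k≥1 (k≤∣∁A∣ A ∣A∣≡k) x
  ... | B , C , p , ∣B∣≡k , x∉C = B , C , Partition⇒IsDeal p ∣A∣≡k ∣B∣≡k , x∉C

lemma2 : (k l : ℕ) → k ≥ 1 → l ≥ 1 → (𝒜 : Family k l) →
         (∀ A → 𝒜 A → ∣ A ∣ ≡ k) → (∃[ A ] 𝒜 A) →
         CathIgnorant k l 𝒜 →
         (∀ (x : Card k l) → ∃[ A ] (𝒜 A × x ∈ A))
         × (∀ (x : Card k l) → ¬ (∀ A → 𝒜 A → x ∈ A))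
lemma2 k l k≥1 _ 𝒜 sizes (A₀ , A₀∈𝒜) ignorant = covered , notCommon
  where
  covered : ∀ (x : Card k l) → ∃[ A ] (𝒜 A × x ∈ A)
  covered x with deal-avoiding k≥1 A₀ (sizes A₀ A₀∈𝒜) x
  ... | B , C , deal , x∉C with ignorant A₀ B C deal A₀∈𝒜 x x∉C
  ...   | (A′ , _ , _ , A′∈𝒜 , x∈A′) , _ = A′ , A′∈𝒜 , x∈A′

  notCommon : ∀ (x : Card k l) → ¬ (∀ A → 𝒜 A → x ∈ A)
  notCommon x x∈all with deal-avoiding k≥1 A₀ (sizes A₀ A₀∈𝒜) x
  ... | B , C , deal , x∉C with ignorant A₀ B C deal A₀∈𝒜 x x∉C
  ...   | _ , (A″ , _ , deal″ , A″∈𝒜 , x∈B″) =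
    IsDeal.disjAB deal″ x (x∈all A″ A″∈𝒜 , x∈B″)
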